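{- Let $\mathcal{C}$ be a category with pushouts and pullbacks equipped with a costable factorisation system $(\mathcal{E},\mathcal{M})$. Let $\mathcal{A}$ be a subcategory of $\mathcal{C}$ containing all isomorphisms and stable under pullback. Suppose that for every cospan $X\xrightarrow{f}A\xleftarrow{g}Y$ with $f,g\in\mathcal{A}$, if $X\leftarrow P\rightarrow Y$ is its pullback in $\mathcal{C}$ and $X\rightarrow Q\leftarrow Y$ is the pushout in $\mathcal{C}$ of this span, then the canonical morphism $Q\to A$ (induced by $f,g$) lies in $\mathcal{M}$. Then sending a span $X\xleftarrow{f}N\xrightarrow{g}Y$ with $f,g\in\mathcal{A}$ to the corelation represented by its pushout cospan in $\mathcal{C}$ (equivalently, the jointly-in-$\mathcal{E}$ part of that pushout cospan) defines an identity-on-objects functor $\Pi\colon\mathrm{Span}(\mathcal{A})\to\mathrm{Corel}(\mathcal{C})$.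
   Context: Composition is written $f;g$ (first $f$ then $g$). A factorisation system $(\mathcal{E},\mathcal{M})$ on $\mathcal{C}$: subcategories containing all isomorphisms, every morphism factors as $e;m$ with $e\in\mathcal{E}$, $m\in\mathcal{M}$, with unique diagonal fill-in for commuting squares between such factorisations. It is costable if $\mathcal{M}$ is stable under pushout (in any pushout square, the morphism opposite to one in $\mathcal{M}$ is in $\mathcal{M}$). A subcategory $\mathcal{A}$ is stable under pullback if in every pullback square in $\mathcal{C}$, whenever a morphism is in $\mathcal{A}$ the morphism opposite to it is in $\mathcal{A}$. $\mathrm{Span}(\mathcal{A})$ is the subcategory of $\mathrm{Span}(\mathcal{C})$ (objects of $\mathcal{C}$, isomorphism classes of spans composed by pullback in $\mathcal{C}$) consisting of spans both of whose legs lie in $\mathcal{A}$. $\mathrm{Corel}(\mathcal{C})$ has the objects of $\mathcal{C}$; its morphisms $X\to Y$ are equivalence classes of cospans $X\xrightarrow{f}N\xleftarrow{g}Y$ under the equivalence relation generated by $(f,g)\sim(f',g')$ whenever there is $m\colon N\to N'$ in $\mathcal{M}$ with $f;m=f'$, $g;m=g'$; composition is induced by pushout composition of cospans. A cospan $X\xrightarrow{p}N\xleftarrow{q}Y$ is jointly-in-$\mathcal{E}$ if the copairing $[p,q]$ lies in $\mathcal{E}$. -}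

module Defs where

open import Level using (Level; _⊔_) renaming (suc to lsuc)
open import Data.Product using (Σ; _×_; _,_)
open import Relation.Binary using (IsEquivalence)

-- Categories (hom-setoid style: morphism equality is an equivalence _≈_)
-- Composition is written in diagrammatic order: f ⨾ g = "first f then g".

record Category (o h e : Level) : Set (lsuc (o ⊔ h ⊔ e)) where
  infixr 9 _⨾_
  infix 4 _≈_
  field
    Obj   : Set o
    Hom   : Obj → Obj → Set h
    _≈_   : ∀ {A B} → Hom A B → Hom A B → Set e
    id    : ∀ {A} → Hom A A
    _⨾_   : ∀ {A B D} → Hom A B → Hom B D → Hom A D
    ≈-equiv : ∀ {A B} → IsEquivalence (_≈_ {A} {B})
    ⨾-cong  : ∀ {A B D} {f f' : Hom A B} {g g' : Hom B D} →
              f ≈ f' → g ≈ g' → f ⨾ g ≈ f' ⨾ g'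
    idˡ   : ∀ {A B} {f : Hom A B} → id ⨾ f ≈ f
    idʳ   : ∀ {A B} {f : Hom A B} → f ⨾ id ≈ f
    assoc : ∀ {A B D K} {f : Hom A B} {g : Hom B D} {k : Hom D K} →
            (f ⨾ g) ⨾ k ≈ f ⨾ (g ⨾ k)

module _ {o h e : Level} (C : Category o h e) where
  open Category C

  MorClass : (ℓ : Level) → Set (o ⊔ h ⊔ lsuc ℓ)
  MorClass ℓ = ∀ {A B} → Hom A B → Set ℓ

  IsIso : ∀ {A B} → Hom A B → Set (h ⊔ e)
  IsIso {A} {B} f = Σ (Hom B A) λ g → (f ⨾ g ≈ id) × (g ⨾ f ≈ id)

  -- A (wide) subcategory containing all isomorphisms, given by its class of
  -- morphisms (closed under ≈, composition; contains isos, hence identities).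
  record IsSubcatWithIsos {ℓ} (P : MorClass ℓ) : Set (o ⊔ h ⊔ e ⊔ ℓ) where
    field
      resp : ∀ {A B} {f g : Hom A B} → f ≈ g → P f → P g
      comp : ∀ {A B D} {f : Hom A B} {g : Hom B D} → P f → P g → P (f ⨾ g)
      isos : ∀ {A B} {f : Hom A B} → IsIso f → P f

  IsPullback : ∀ {P X Y A} → Hom P X → Hom P Y → Hom X A → Hom Y A →
               Set (o ⊔ h ⊔ e)
  IsPullback {P} {X} {Y} {A} p1 p2 f g =
    (p1 ⨾ f ≈ p2 ⨾ g) ×
    (∀ {Z} (z1 : Hom Z X) (z2 : Hom Z Y) → z1 ⨾ f ≈ z2 ⨾ g →
       Σ (Hom Z P) λ u → ((u ⨾ p1 ≈ z1) × (u ⨾ p2 ≈ z2)) ×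
         (∀ (u' : Hom Z P) → u' ⨾ p1 ≈ z1 → u' ⨾ p2 ≈ z2 → u' ≈ u))

  IsPushout : ∀ {S X Y Q} → Hom S X → Hom S Y → Hom X Q → Hom Y Q →
              Set (o ⊔ h ⊔ e)
  IsPushout {S} {X} {Y} {Q} a b q1 q2 =
    (a ⨾ q1 ≈ b ⨾ q2) ×
    (∀ {Z} (z1 : Hom X Z) (z2 : Hom Y Z) → a ⨾ z1 ≈ b ⨾ z2 →
       Σ (Hom Q Z) λ u → ((q1 ⨾ u ≈ z1) × (q2 ⨾ u ≈ z2)) ×
         (∀ (u' : Hom Q Z) → q1 ⨾ u' ≈ z1 → q2 ⨾ u' ≈ z2 → u' ≈ u))

  record PullbackOf {X Y A} (f : Hom X A) (g : Hom Y A) : Set (o ⊔ h ⊔ e) where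
    field
      P  : Obj
      π₁ : Hom P X
      π₂ : Hom P Y
      isPullback : IsPullback π₁ π₂ f g

  record PushoutOf {S X Y} (a : Hom S X) (b : Hom S Y) : Set (o ⊔ h ⊔ e) where
    field
      Q  : Obj
      ι₁ : Hom X Q
      ι₂ : Hom Y Q
      isPushout : IsPushout a b ι₁ ι₂

  HasPullbacks : Set (o ⊔ h ⊔ e)
  HasPullbacks = ∀ {X Y A} (f : Hom X A) (g : Hom Y A) → PullbackOf f g

  HasPushouts : Set (o ⊔ h ⊔ e)
  HasPushouts = ∀ {S X Y} (a : Hom S X) (b : Hom S Y) → PushoutOf a b

  record IsFactorisationSystem {ℓE ℓM} (E : MorClass ℓE) (M : MorClass ℓM)
         : Set (o ⊔ h ⊔ e ⊔ ℓE ⊔ ℓM) where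
    field
      E-subcat : IsSubcatWithIsos E
      M-subcat : IsSubcatWithIsos M
      factor   : ∀ {A B} (f : Hom A B) →
                 Σ Obj λ K → Σ (Hom A K) λ ε → Σ (Hom K B) λ μ →
                   E ε × M μ × (ε ⨾ μ ≈ f)
      fill     : ∀ {A B D K} (ε : Hom A B) (μ : Hom D K) → E ε → M μ →
                 (u : Hom A D) (v : Hom B K) → ε ⨾ v ≈ u ⨾ μ →
                 Σ (Hom B D) λ d → ((ε ⨾ d ≈ u) × (d ⨾ μ ≈ v)) ×
                   (∀ (d' : Hom B D) → ε ⨾ d' ≈ u → d' ⨾ μ ≈ v → d' ≈ d)

  CostableClass : ∀ {ℓ} → MorClass ℓ → Set (o ⊔ h ⊔ e ⊔ ℓ)
  CostableClass M =
    ∀ {S X Y Q} {a : Hom S X} {b : Hom S Y} {q1 : Hom X Q} {q2 : Hom Y Q} →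
      IsPushout a b q1 q2 → (M a → M q2) × (M b → M q1)

  PullbackStable : ∀ {ℓ} → MorClass ℓ → Set (o ⊔ h ⊔ e ⊔ ℓ)
  PullbackStable A =
    ∀ {P X Y B} {p1 : Hom P X} {p2 : Hom P Y} {f : Hom X B} {g : Hom Y B} →
      IsPullback p1 p2 f g → (A f → A p2) × (A g → A p1)

  CanonicalInM : ∀ {ℓA ℓM} → MorClass ℓA → MorClass ℓM →
                 Set (o ⊔ h ⊔ e ⊔ ℓA ⊔ ℓM)
  CanonicalInM A M =
    ∀ {X Y B} (f : Hom X B) (g : Hom Y B) → A f → A g →
    ∀ {P} (p1 : Hom P X) (p2 : Hom P Y) → IsPullback p1 p2 f g →
    ∀ {Q} (q1 : Hom X Q) (q2 : Hom Y Q) → IsPushout p1 p2 q1 q2 →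
    ∀ (u : Hom Q B) → q1 ⨾ u ≈ f → q2 ⨾ u ≈ g → M u

  record Span (X Y : Obj) : Set (o ⊔ h) where
    constructor span
    field
      apex : Obj
      legˡ : Hom apex X
      legʳ : Hom apex Y

  record Cospan (X Y : Obj) : Set (o ⊔ h) where
    constructor cospan
    field
      apex : Obj
      legˡ : Hom X apex
      legʳ : Hom Y apex

  SpanIn : ∀ {ℓ} → MorClass ℓ → ∀ {X Y} → Span X Y → Set ℓ
  SpanIn A s = A (Span.legˡ s) × A (Span.legʳ s)

  -- isomorphism of spans (the equivalence defining morphisms of Span(C))
  SpanIso : ∀ {X Y} → Span X Y → Span X Y → Set (h ⊔ e)
  SpanIso s s' =
    Σ (Hom (Span.apex s) (Span.apex s')) λ φ →
      IsIso φ × (φ ⨾ Span.legˡ s' ≈ Span.legˡ s) × (φ ⨾ Span.legʳ s' ≈ Span.legʳ s)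

  idSpan : ∀ X → Span X X
  idSpan X = span X id id

  idCospan : ∀ X → Cospan X X
  idCospan X = cospan X id id

  spanComp : HasPullbacks → ∀ {X Y Z} → Span X Y → Span Y Z → Span X Z
  spanComp pb s t =
    span P (π₁ ⨾ Span.legˡ s) (π₂ ⨾ Span.legʳ t)
    where open PullbackOf (pb (Span.legʳ s) (Span.legˡ t))

  cospanComp : HasPushouts → ∀ {X Y Z} → Cospan X Y → Cospan Y Z → Cospan X Z
  cospanComp po c d =
    cospan Q (Cospan.legˡ c ⨾ ι₁) (Cospan.legʳ d ⨾ ι₂)
    where open PushoutOf (po (Cospan.legʳ c) (Cospan.legˡ d))

  -- Corelation equivalence: the equivalence relation generated by
  -- (f , g) ~ (f ⨾ m , g ⨾ m) for m ∈ M.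
  data CorelEq {ℓM} (M : MorClass ℓM) {X Y : Obj} :
               Cospan X Y → Cospan X Y → Set (o ⊔ h ⊔ e ⊔ ℓM) where
    step  : ∀ {c c'} (m : Hom (Cospan.apex c) (Cospan.apex c')) → M m →
            Cospan.legˡ c ⨾ m ≈ Cospan.legˡ c' →
            Cospan.legʳ c ⨾ m ≈ Cospan.legʳ c' → CorelEq M c c'
    refl  : ∀ {c} → CorelEq M c c
    sym   : ∀ {c c'} → CorelEq M c c' → CorelEq M c' c
    trans : ∀ {c c' c''} → CorelEq M c c' → CorelEq M c' c'' → CorelEq M c c''

  Π : HasPushouts → ∀ {X Y} → Span X Y → Cospan X Y
  Π po s = cospan Q ι₁ ι₂
    where open PushoutOf (po (Span.legˡ s) (Span.legʳ s))

  record IsΠFunctor {ℓA ℓM} (pb : HasPullbacks) (po : HasPushouts)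
         (A : MorClass ℓA) (M : MorClass ℓM) : Set (o ⊔ h ⊔ e ⊔ ℓA ⊔ ℓM) where
    field
      well-defined : ∀ {X Y} (s s' : Span X Y) → SpanIn A s → SpanIn A s' →
                     SpanIso s s' → CorelEq M (Π po s) (Π po s')
      pres-id      : ∀ X → CorelEq M (Π po (idSpan X)) (idCospan X)
      pres-comp    : ∀ {X Y Z} (s : Span X Y) (t : Span Y Z) →
                     SpanIn A s → SpanIn A t →
                     CorelEq M (Π po (spanComp pb s t))
                               (cospanComp po (Π po s) (Π po t))

-- Isomorphic spans have isomorphic pushouts, and the pushout of (id, id) has
-- equal legs, so it is an M-image of the identity cospan. For composition, let
-- P be the pullback of the inner legs N → Y ← N' and K the pushout of
-- N ← P → N'. The pushout Q of the composite span maps to the composite R of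
-- the two pushout cospans, and the square K → Q → R, K → Y → R is a pushout,
-- since both sides glue the same pieces of X ← N → Y ← N' → Z. The comparison
-- K → Y lies in M by hypothesis, so Q → R does by costability.
module Submission where

open import Level using (Level)
open import Data.Product using (_,_; proj₁; proj₂)
open import Relation.Binary using (IsEquivalence; Setoid)
import Relation.Binary.Reasoning.Setoid as SetoidReasoning
open import Defs

module _ {o h e : Level} (C : Category o h e) where
  open Category C

  module ≈ {A B} = IsEquivalence (≈-equiv {A} {B})

  hom-setoid : Obj → Obj → Setoid h e
  hom-setoid A B = record { isEquivalence = ≈-equiv {A} {B} }

  module HomReasoning {A B} = SetoidReasoning (hom-setoid A B)
  open HomReasoning

  ⨾-congˡ : ∀ {A B D} {f f' : Hom A B} {g : Hom B D} → f ≈ f' → f ⨾ g ≈ f' ⨾ g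
  ⨾-congˡ p = ⨾-cong p ≈.refl

  ⨾-congʳ : ∀ {A B D} {f : Hom A B} {g g' : Hom B D} → g ≈ g' → f ⨾ g ≈ f ⨾ g'
  ⨾-congʳ p = ⨾-cong ≈.refl p

  pullˡ : ∀ {A B D K} {f : Hom A B} {g : Hom B D} {fg : Hom A D} {k : Hom D K} →
          f ⨾ g ≈ fg → f ⨾ (g ⨾ k) ≈ fg ⨾ k
  pullˡ p = ≈.trans (≈.sym assoc) (⨾-congˡ p)

  extend : ∀ {A B B' D K} {f : Hom A B} {g : Hom B D} {f' : Hom A B'} {g' : Hom B' D}
           {k : Hom D K} → f ⨾ g ≈ f' ⨾ g' → f ⨾ (g ⨾ k) ≈ f' ⨾ (g' ⨾ k)
  extend p = ≈.trans (pullˡ p) assoc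

  module Pushout {S X Y Q} {a : Hom S X} {b : Hom S Y} {q₁ : Hom X Q} {q₂ : Hom Y Q}
                 (isPushout : IsPushout C a b q₁ q₂) where

    commute : a ⨾ q₁ ≈ b ⨾ q₂
    commute = proj₁ isPushout

    module _ {Z} {z₁ : Hom X Z} {z₂ : Hom Y Z} (eq : a ⨾ z₁ ≈ b ⨾ z₂) where

      universal : Hom Q Z
      universal = proj₁ (proj₂ isPushout z₁ z₂ eq)

      universal-q₁ : q₁ ⨾ universal ≈ z₁
      universal-q₁ = proj₁ (proj₁ (proj₂ (proj₂ isPushout z₁ z₂ eq)))

      universal-q₂ : q₂ ⨾ universal ≈ z₂
      universal-q₂ = proj₂ (proj₁ (proj₂ (proj₂ isPushout z₁ z₂ eq)))

    jointly-epic : ∀ {Z} {u v : Hom Q Z} → q₁ ⨾ u ≈ q₁ ⨾ v → q₂ ⨾ u ≈ q₂ ⨾ v → u ≈ v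
    jointly-epic {u = u} {v} p₁ p₂ =
      ≈.trans (unique u p₁ p₂) (≈.sym (unique v ≈.refl ≈.refl))
      where unique = proj₂ (proj₂ (proj₂ isPushout (q₁ ⨾ v) (q₂ ⨾ v) (extend commute)))

  module _ {S S' X Y Q Q'} {a : Hom S X} {b : Hom S Y} {a' : Hom S' X} {b' : Hom S' Y}
           {q₁ : Hom X Q} {q₂ : Hom Y Q} {q₁' : Hom X Q'} {q₂' : Hom Y Q'}
           (P : IsPushout C a b q₁ q₂) (P' : IsPushout C a' b' q₁' q₂')
           (eq : a ⨾ q₁' ≈ b ⨾ q₂') (eq' : a' ⨾ q₁ ≈ b' ⨾ q₂) where
    open Pushout

    pushout-comparison-section : universal P eq ⨾ universal P' eq' ≈ id
    pushout-comparison-section = jointly-epic P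
      (≈.trans (pullˡ (universal-q₁ P eq)) (≈.trans (universal-q₁ P' eq') (≈.sym idʳ)))
      (≈.trans (pullˡ (universal-q₂ P eq)) (≈.trans (universal-q₂ P' eq') (≈.sym idʳ)))

  pushout-comparison-isIso :
    ∀ {S S' X Y Q Q'} {a : Hom S X} {b : Hom S Y} {a' : Hom S' X} {b' : Hom S' Y}
      {q₁ : Hom X Q} {q₂ : Hom Y Q} {q₁' : Hom X Q'} {q₂' : Hom Y Q'}
      (P : IsPushout C a b q₁ q₂) (P' : IsPushout C a' b' q₁' q₂')
      (eq : a ⨾ q₁' ≈ b ⨾ q₂') (eq' : a' ⨾ q₁ ≈ b' ⨾ q₂) →
      IsIso C (Pushout.universal P eq)
  pushout-comparison-isIso P P' eq eq' =
    Pushout.universal P' eq' ,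
    pushout-comparison-section P P' eq eq' ,
    pushout-comparison-section P' P eq' eq

  SpanIso-sym : ∀ {X Y} {s s' : Span C X Y} → SpanIso C s s' → SpanIso C s' s
  SpanIso-sym {s = span N _ _} {span N' _ _} (φ , (ψ , φψ , ψφ) , φl , φr) =
    ψ , (φ , ψφ , φψ) , transpose φl , transpose φr
    where
    transpose : ∀ {Z} {f : Hom N Z} {f' : Hom N' Z} → φ ⨾ f' ≈ f → ψ ⨾ f ≈ f'
    transpose {f = f} {f'} p = begin
      ψ ⨾ f         ≈⟨ ⨾-congʳ p ⟨
      ψ ⨾ (φ ⨾ f')  ≈⟨ pullˡ ψφ ⟩
      id ⨾ f'       ≈⟨ idˡ ⟩
      f'            ∎

  SpanIso-cocone : ∀ {X Y Z} {s s' : Span C X Y} → SpanIso C s s' →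
                   {z₁ : Hom X Z} {z₂ : Hom Y Z} →
                   Span.legˡ s' ⨾ z₁ ≈ Span.legʳ s' ⨾ z₂ →
                   Span.legˡ s ⨾ z₁ ≈ Span.legʳ s ⨾ z₂
  SpanIso-cocone {s = span _ l r} {span _ l' r'} (φ , _ , φl , φr) {z₁} {z₂} p = begin
    l ⨾ z₁          ≈⟨ ⨾-congˡ φl ⟨
    (φ ⨾ l') ⨾ z₁   ≈⟨ assoc ⟩
    φ ⨾ (l' ⨾ z₁)   ≈⟨ ⨾-congʳ p ⟩
    φ ⨾ (r' ⨾ z₂)   ≈⟨ pullˡ φr ⟩
    r ⨾ z₂          ∎

  module CompositeSpanPushout
    {P N N' X Y Z : Obj} {π₁ : Hom P N} {π₂ : Hom P N'}
    {l : Hom N X} {r : Hom N Y} {l' : Hom N' Y} {r' : Hom N' Z}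
    (square : π₁ ⨾ r ≈ π₂ ⨾ l')
    {K : Obj} {k₁ : Hom N K} {k₂ : Hom N' K} (K-po : IsPushout C π₁ π₂ k₁ k₂)
    {Q : Obj} {ι₁ : Hom X Q} {ι₂ : Hom Z Q} (Q-po : IsPushout C (π₁ ⨾ l) (π₂ ⨾ r') ι₁ ι₂)
    {S : Obj} {a₁ : Hom X S} {a₂ : Hom Y S} (S-po : IsPushout C l r a₁ a₂)
    {T : Obj} {b₁ : Hom Y T} {b₂ : Hom Z T} (T-po : IsPushout C l' r' b₁ b₂)
    {R : Obj} {c₁ : Hom S R} {c₂ : Hom T R} (R-po : IsPushout C a₂ b₁ c₁ c₂)
    where

    private
      module K = Pushout K-po
      module Q = Pushout Q-po
      module S = Pushout S-po
      module T = Pushout T-po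
      module R = Pushout R-po

    κ : Hom K Y
    κ = K.universal square

    κ₁ : k₁ ⨾ κ ≈ r
    κ₁ = K.universal-q₁ square

    κ₂ : k₂ ⨾ κ ≈ l'
    κ₂ = K.universal-q₂ square

    j-cocone : π₁ ⨾ (l ⨾ ι₁) ≈ π₂ ⨾ (r' ⨾ ι₂)
    j-cocone = ≈.trans (≈.sym assoc) (≈.trans Q.commute assoc)

    j : Hom K Q
    j = K.universal j-cocone

    m-cocone : (π₁ ⨾ l) ⨾ (a₁ ⨾ c₁) ≈ (π₂ ⨾ r') ⨾ (b₂ ⨾ c₂)
    m-cocone = begin
      (π₁ ⨾ l) ⨾ (a₁ ⨾ c₁)    ≈⟨ assoc ⟩
      π₁ ⨾ (l ⨾ (a₁ ⨾ c₁))    ≈⟨ ⨾-congʳ (extend S.commute) ⟩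
      π₁ ⨾ (r ⨾ (a₂ ⨾ c₁))    ≈⟨ ⨾-congʳ (⨾-congʳ R.commute) ⟩
      π₁ ⨾ (r ⨾ (b₁ ⨾ c₂))    ≈⟨ extend square ⟩
      π₂ ⨾ (l' ⨾ (b₁ ⨾ c₂))   ≈⟨ ⨾-congʳ (extend T.commute) ⟩
      π₂ ⨾ (r' ⨾ (b₂ ⨾ c₂))   ≈⟨ assoc ⟨
      (π₂ ⨾ r') ⨾ (b₂ ⨾ c₂)   ∎

    m : Hom Q R
    m = Q.universal m-cocone

    m₁ : ι₁ ⨾ m ≈ a₁ ⨾ c₁
    m₁ = Q.universal-q₁ m-cocone

    m₂ : ι₂ ⨾ m ≈ b₂ ⨾ c₂
    m₂ = Q.universal-q₂ m-cocone

    y : Hom Y R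
    y = a₂ ⨾ c₁

    y-via-T : y ≈ b₁ ⨾ c₂
    y-via-T = R.commute

    commutes : j ⨾ m ≈ κ ⨾ y
    commutes = K.jointly-epic
      (begin
        k₁ ⨾ (j ⨾ m)          ≈⟨ pullˡ (K.universal-q₁ j-cocone) ⟩
        (l ⨾ ι₁) ⨾ m          ≈⟨ assoc ⟩
        l ⨾ (ι₁ ⨾ m)          ≈⟨ ⨾-congʳ m₁ ⟩
        l ⨾ (a₁ ⨾ c₁)         ≈⟨ extend S.commute ⟩
        r ⨾ y                 ≈⟨ pullˡ κ₁ ⟨
        k₁ ⨾ (κ ⨾ y)          ∎)
      (begin
        k₂ ⨾ (j ⨾ m)          ≈⟨ pullˡ (K.universal-q₂ j-cocone) ⟩
        (r' ⨾ ι₂) ⨾ m         ≈⟨ assoc ⟩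
        r' ⨾ (ι₂ ⨾ m)         ≈⟨ ⨾-congʳ m₂ ⟩
        r' ⨾ (b₂ ⨾ c₂)        ≈⟨ extend T.commute ⟨
        l' ⨾ (b₁ ⨾ c₂)        ≈⟨ ⨾-congʳ y-via-T ⟨
        l' ⨾ y                ≈⟨ pullˡ κ₂ ⟨
        k₂ ⨾ (κ ⨾ y)          ∎)

    jointly-epic : ∀ {W} {u v : Hom R W} → m ⨾ u ≈ m ⨾ v → y ⨾ u ≈ y ⨾ v → u ≈ v
    jointly-epic p₁ p₂ = R.jointly-epic
      (S.jointly-epic
        (≈.trans (≈.sym (extend m₁)) (≈.trans (⨾-congʳ p₁) (extend m₁)))
        (≈.trans (≈.sym assoc) (≈.trans p₂ assoc)))
      (T.jointly-epic
        (≈.trans (pullˡ (≈.sym y-via-T)) (≈.trans p₂ (≈.sym (pullˡ (≈.sym y-via-T)))))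
        (≈.trans (≈.sym (extend m₂)) (≈.trans (⨾-congʳ p₁) (extend m₂))))

    module _ {W} {z₁ : Hom Q W} {z₂ : Hom Y W} (p : j ⨾ z₁ ≈ κ ⨾ z₂) where

      transfer : ∀ {D B} {k : Hom D K} {f : Hom D B} {ι : Hom B Q} {g : Hom D Y} →
                 k ⨾ j ≈ f ⨾ ι → k ⨾ κ ≈ g → f ⨾ (ι ⨾ z₁) ≈ g ⨾ z₂
      transfer {k = k} {f} {ι} {g} kj kκ = begin
        f ⨾ (ι ⨾ z₁)   ≈⟨ extend kj ⟨
        k ⨾ (j ⨾ z₁)   ≈⟨ ⨾-congʳ p ⟩
        k ⨾ (κ ⨾ z₂)   ≈⟨ pullˡ kκ ⟩
        g ⨾ z₂         ∎

      S-cocone : l ⨾ (ι₁ ⨾ z₁) ≈ r ⨾ z₂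
      S-cocone = transfer (K.universal-q₁ j-cocone) κ₁

      T-cocone : l' ⨾ z₂ ≈ r' ⨾ (ι₂ ⨾ z₁)
      T-cocone = ≈.sym (transfer (K.universal-q₂ j-cocone) κ₂)

      R-cocone : a₂ ⨾ S.universal S-cocone ≈ b₁ ⨾ T.universal T-cocone
      R-cocone = ≈.trans (S.universal-q₂ S-cocone) (≈.sym (T.universal-q₁ T-cocone))

      mediator : Hom R W
      mediator = R.universal R-cocone

      mediator-m : m ⨾ mediator ≈ z₁
      mediator-m = Q.jointly-epic
        (≈.trans (extend m₁) (≈.trans (⨾-congʳ (R.universal-q₁ R-cocone))
                                      (S.universal-q₁ S-cocone)))
        (≈.trans (extend m₂) (≈.trans (⨾-congʳ (R.universal-q₂ R-cocone))
                                      (T.universal-q₂ T-cocone)))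

      mediator-y : y ⨾ mediator ≈ z₂
      mediator-y = ≈.trans assoc (≈.trans (⨾-congʳ (R.universal-q₁ R-cocone))
                                          (S.universal-q₂ S-cocone))

    isPushout : IsPushout C j κ m y
    isPushout = commutes , λ z₁ z₂ p →
      mediator p , (mediator-m p , mediator-y p) , λ u u-m u-y →
        jointly-epic (≈.trans u-m (≈.sym (mediator-m p)))
                     (≈.trans u-y (≈.sym (mediator-y p)))

  module _ (po : HasPushouts C) {ℓM : Level} {M : MorClass C ℓM}
           (M-isos : ∀ {A B} {f : Hom A B} → IsIso C f → M f) where

    Π-well-defined : ∀ {X Y} (s s' : Span C X Y) → SpanIso C s s' →
                     CorelEq C M (Π C po s) (Π C po s')
    Π-well-defined s s' iso =
      step (universal P eq) (M-isos (pushout-comparison-isIso P P' eq eq'))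
           (universal-q₁ P eq) (universal-q₂ P eq)
      where
      open Pushout
      P  = PushoutOf.isPushout (po (Span.legˡ s) (Span.legʳ s))
      P' = PushoutOf.isPushout (po (Span.legˡ s') (Span.legʳ s'))
      eq  = SpanIso-cocone iso (commute P')
      eq' = SpanIso-cocone (SpanIso-sym iso) (commute P)

    Π-identity : CostableClass C M → ∀ X → CorelEq C M (Π C po (idSpan C X)) (idCospan C X)
    Π-identity costable X =
      sym (step ι₁ (proj₂ (costable isPushout) (M-isos (id , idˡ , idˡ)))
                idˡ (≈.trans idˡ legs-equal))
      where
      open PushoutOf (po {X} id id)
      legs-equal : ι₁ ≈ ι₂
      legs-equal = ≈.trans (≈.sym idˡ) (≈.trans (proj₁ isPushout) idˡ)

  Π-homomorphism : (pb : HasPullbacks C) (po : HasPushouts C)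
                   {ℓA ℓM : Level} {A : MorClass C ℓA} {M : MorClass C ℓM} →
                   CostableClass C M → CanonicalInM C A M →
                   ∀ {X Y Z} (s : Span C X Y) (t : Span C Y Z) →
                   A (Span.legʳ s) → A (Span.legˡ t) →
                   CorelEq C M (Π C po (spanComp C pb s t))
                               (cospanComp C po (Π C po s) (Π C po t))
  Π-homomorphism pb po costable canonical (span _ l r) (span _ l' r') A-r A-l' =
    step m (proj₂ (costable isPushout) κ∈M) m₁ m₂
    where
    module PB = PullbackOf (pb r l')
    module K = PushoutOf (po PB.π₁ PB.π₂)
    module S = PushoutOf (po l r)
    module T = PushoutOf (po l' r')
    open CompositeSpanPushout (proj₁ PB.isPullback) K.isPushout
      (PushoutOf.isPushout (po (PB.π₁ ⨾ l) (PB.π₂ ⨾ r')))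
      S.isPushout T.isPushout (PushoutOf.isPushout (po S.ι₂ T.ι₁))
    κ∈M = canonical r l' A-r A-l' PB.π₁ PB.π₂ PB.isPullback
                    K.ι₁ K.ι₂ K.isPushout κ κ₁ κ₂

proposition2p9 : ∀ {o h e ℓE ℓM ℓA : Level} (C : Category o h e)
    (pb : HasPullbacks C) (po : HasPushouts C)
    (E : MorClass C ℓE) (M : MorClass C ℓM) →
    IsFactorisationSystem C E M → CostableClass C M →
    (A : MorClass C ℓA) → IsSubcatWithIsos C A → PullbackStable C A →
    CanonicalInM C A M →
    IsΠFunctor C pb po A M
proposition2p9 C pb po _ _ fs costable _ _ _ canonical = record
  { well-defined = λ s s' _ _ → Π-well-defined C po M-isos s s'
  ; pres-id      = Π-identity C po M-isos costable
  ; pres-comp    = λ s t (_ , A-r) (A-l' , _) →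
                     Π-homomorphism C pb po costable canonical s t A-r A-l'
  }
  where M-isos = IsSubcatWithIsos.isos (IsFactorisationSystem.M-subcat fs)
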